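{- Let $\rho$ be any order type. Then both the type $\tau=\sum_{n\in\omega}\rho^n = 1+\rho+\rho^2+\cdots$ and the type $\tau'=\sum_{n\in\omega^*}\rho^n=\cdots+\rho^2+\rho+1$ are untranscendable.
   Context: Work in ZFC. Order types are isomorphism classes of linear orders; $\varphi\leqslant\psi$ means an order of type $\varphi$ embeds in one of type $\psi$; $\varphi<\psi$ means $\varphi\leqslant\psi$ and not $\psi\leqslant\varphi$. For a linear order $X$ and orders $I_x$ ($x\in X$), the ordered sum $\sum_{x\in X}I_x$ is the set $\{(i,x): x\in X, i\in I_x\}$ with $(i,x)<(i',x')$ iff $x<x'$, or $x=x'$ and $i<i'$. The product $YX$ is $\sum_{x\in X}Y$, and $\rho^n$ is the $n$-fold product ($\rho^0=1$). $\omega$ is the type of $\mathbb{N}$ and $\omega^*$ its reverse. A type $\varphi$ is untranscendable if there are no types $\psi<\varphi$, $\tau<\varphi$ with $\varphi\leqslant\psi\tau$. -}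

module Defs where

open import Level using (Level; Lift; lift; lower) renaming (suc to lsuc)
open import Data.Nat as ℕ using (ℕ; zero; suc)
import Data.Nat.Properties as ℕP
open import Data.Unit using (⊤; tt)
open import Data.Empty using (⊥)
open import Data.Product using (Σ; _,_; proj₁; proj₂; _×_)
open import Relation.Nullary using (¬_)
open import Relation.Binary.Core using (Rel)
open import Relation.Binary.Definitions using (Trichotomous; Tri; tri<; tri≈; tri>)
open import Relation.Binary.PropositionalEquality using (_≡_; refl; cong)

record LinOrder (ℓ : Level) : Set (lsuc ℓ) where
  field
    Carrier : Set ℓ
    _<_     : Rel Carrier ℓ
    irrefl  : ∀ {x} → ¬ (x < x)
    trans   : ∀ {x y z} → x < y → y < z → x < z
    compare : Trichotomous _≡_ _<_

open LinOrder public using (Carrier)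

module _ {ℓ : Level} where

  -- φ ≤ ψ : an order of type φ embeds in one of type ψ
  -- (an order embedding between linear orders = a strictly increasing map).
  _≼_ : LinOrder ℓ → LinOrder ℓ → Set ℓ
  A ≼ B = Σ (Carrier A → Carrier B) λ f →
            ∀ {x y} → LinOrder._<_ A x y → LinOrder._<_ B (f x) (f y)

  _≺_ : LinOrder ℓ → LinOrder ℓ → Set ℓ
  A ≺ B = (A ≼ B) × ¬ (B ≼ A)

  module _ (X : LinOrder ℓ) (I : Carrier X → LinOrder ℓ) where
    private
      module X = LinOrder X
      module I (x : Carrier X) = LinOrder (I x)
      S = Σ (Carrier X) λ x → Carrier (I x)

    data Lex : S → S → Set ℓ where
      here  : ∀ {x x' i i'} → X._<_ x x' → Lex (x , i) (x' , i')
      there : ∀ {x i i'} → I._<_ x i i' → Lex (x , i) (x , i')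

    private
      lex-irrefl : ∀ {p} → ¬ Lex p p
      lex-irrefl (here a)  = X.irrefl a
      lex-irrefl (there {x} a) = I.irrefl x a

      lex-trans : ∀ {p q r} → Lex p q → Lex q r → Lex p r
      lex-trans (here a)  (here b)  = here (X.trans a b)
      lex-trans (here a)  (there b) = here a
      lex-trans (there a) (here b)  = here b
      lex-trans (there {x} a) (there b) = there (I.trans x a b)

      notLex<X : ∀ {x x' i i'} → X._<_ x x' → ¬ Lex (x' , i') (x , i)
      notLex<X a (here b)  = X.irrefl (X.trans a b)
      notLex<X a (there b) = X.irrefl a

      notEq<X : ∀ {x x' i i'} → X._<_ x x' → ¬ (_≡_ {A = S} (x , i) (x' , i'))
      notEq<X a refl = X.irrefl a

      lex-cmp-same : ∀ x (i i' : Carrier (I x)) →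
                     Tri (Lex (x , i) (x , i')) (_≡_ {A = S} (x , i) (x , i')) (Lex (x , i') (x , i))
      lex-cmp-same x i i' with I.compare x i i'
      ... | tri< a _ _ = tri< (there a) (λ { refl → I.irrefl x a })
                               (λ { (here b) → X.irrefl b
                                  ; (there b) → I.irrefl x (I.trans x a b) })
      ... | tri≈ _ refl _ = tri≈ lex-irrefl refl lex-irrefl
      ... | tri> _ _ c = tri> (λ { (here b) → X.irrefl b
                                  ; (there b) → I.irrefl x (I.trans x c b) })
                               (λ { refl → I.irrefl x c }) (there c)

      lex-cmp : Trichotomous _≡_ Lex
      lex-cmp (x , i) (x' , i') with X.compare x x'
      ... | tri< a _ _ = tri< (here a) (notEq<X a) (notLex<X a)
      ... | tri≈ _ refl _ = lex-cmp-same x i i'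
      ... | tri> _ _ c = tri> (notLex<X c) (λ e → notEq<X c (Relation.Binary.PropositionalEquality.sym e)) (here c)

    ∑ : LinOrder ℓ
    ∑ = record
      { Carrier = S ; _<_ = Lex ; irrefl = lex-irrefl
      ; trans = lex-trans ; compare = lex-cmp }

  _·_ : LinOrder ℓ → LinOrder ℓ → LinOrder ℓ
  Y · X = ∑ X (λ _ → Y)

  𝟙 : LinOrder ℓ
  𝟙 = record
    { Carrier = Lift ℓ ⊤ ; _<_ = λ _ _ → Lift ℓ ⊥
    ; irrefl = λ () ; trans = λ ()
    ; compare = λ { (lift tt) (lift tt) → tri≈ (λ ()) refl (λ ()) } }

  _^_ : LinOrder ℓ → ℕ → LinOrder ℓ
  ρ ^ zero  = 𝟙
  ρ ^ suc n = (ρ ^ n) · ρ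

  ω : LinOrder ℓ
  ω = record
    { Carrier = Lift ℓ ℕ
    ; _<_ = λ m n → Lift ℓ (lower m ℕ.< lower n)
    ; irrefl = λ { (lift p) → ℕP.<-irrefl refl p }
    ; trans = λ { (lift p) (lift q) → lift (ℕP.<-trans p q) }
    ; compare = cmp }
    where
    cmp : Trichotomous _≡_ (λ m n → Lift ℓ (lower m ℕ.< lower n))
    cmp (lift m) (lift n) with ℕP.<-cmp m n
    ... | tri< a b c = tri< (lift a) (λ { refl → b refl }) (λ { (lift z) → c z })
    ... | tri≈ a refl c = tri≈ (λ { (lift z) → a z }) refl (λ { (lift z) → c z })
    ... | tri> a b c = tri> (λ { (lift z) → a z }) (λ { refl → b refl }) (lift c)

  _* : LinOrder ℓ → LinOrder ℓ
  A * = record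
    { Carrier = Carrier A ; _<_ = λ x y → LinOrder._<_ A y x
    ; irrefl = LinOrder.irrefl A
    ; trans = λ p q → LinOrder.trans A q p
    ; compare = λ x y → flip (LinOrder.compare A x y) }
    where
    flip : ∀ {x y} → Tri (LinOrder._<_ A x y) (x ≡ y) (LinOrder._<_ A y x)
                   → Tri (LinOrder._<_ A y x) (x ≡ y) (LinOrder._<_ A x y)
    flip (tri< a b c) = tri> c b a
    flip (tri≈ a b c) = tri≈ c b a
    flip (tri> a b c) = tri< c b a

  Untranscendable : LinOrder ℓ → Set (lsuc ℓ)
  Untranscendable φ = ∀ (ψ τ : LinOrder ℓ) → ψ ≺ φ → τ ≺ φ → ¬ (φ ≼ (ψ · τ))

  powerSumω : LinOrder ℓ → LinOrder ℓ
  powerSumω ρ = ∑ ω (λ n → ρ ^ lower n)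

  powerSumω* : LinOrder ℓ → LinOrder ℓ
  powerSumω* ρ = ∑ (ω *) (λ n → ρ ^ lower n)

-- Write τ = Σₙ ρⁿ. The key fact is that AB ↪ PQ implies A ↪ P or B ↪ Q: either some copy
-- of A inside AB lands in a single copy of P, or every copy of A meets two copies of P, and
-- choosing one such point per copy yields B ↪ Q.
-- Call τ absorbing if every suborder of τ containing all ρⁿ contains τ. Then ψ, σ < τ give
-- ρⁿ ⋠ ψ and ρᵐ ⋠ σ for some n, m, so ρⁿρᵐ ↪ τ ↪ ψσ is impossible. If ρ has two comparable
-- points, τ is absorbing. Let X ↪ τ contain every ρⁿ. If ρʲρ ↪ ρʲ for some j, then ρʲ
-- contains ω and every ρⁿ, hence ρʲρʲ ↪ X contains τ. If every ρᵐ embeds in ω, so does τ,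
-- and X, containing arbitrarily long finite chains, contains ω. Otherwise, splitting
-- ρᵃρᵐ ↪ X with ρᵐ ⋠ ω puts a copy of ρᵃ inside a single block ρʲ of τ, where necessarily
-- j ≥ a; stacking such copies on increasing blocks embeds τ in X. A one-point ρ gives τ ≅ ω,
-- an empty ρ gives τ ≅ 1, and Σ_{ω*} ρⁿ is the reverse of Σ_ω (ρ*)ⁿ.
module Submission where

open import Defs
open import Level using (Level; lift; lower)
open import Data.Nat as ℕ using (ℕ; zero; suc; _+_; _*_; z≤n; _≤′_; ≤′-refl; ≤′-step)
import Data.Nat.Properties as ℕ
open import Data.Unit using (tt)
open import Data.Empty using (⊥-elim)
open import Data.Product using (Σ; ∃; ∃₂; _,_; proj₁; proj₂; _×_)
open import Data.Sum using (_⊎_; inj₁; inj₂; fromInj₂)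
open import Function using (_∘_)
open import Relation.Nullary using (¬_; yes; no)
open import Relation.Binary.Bundles using (Preorder)
open import Relation.Binary.Definitions using (tri<; tri≈; tri>)
open import Relation.Binary.PropositionalEquality using (_≡_; refl; sym; subst₂; isEquivalence)
import Relation.Binary.Reasoning.Preorder as PreorderReasoning
open import Axiom.ExcludedMiddle using (ExcludedMiddle)
open import Axiom.DoubleNegationElimination using (em⇒dne)

module _ {ℓ : Level} where

  Lt : (A : LinOrder ℓ) → Carrier A → Carrier A → Set ℓ
  Lt = LinOrder._<_

  syntax Lt A x y = x <[ A ] y

  ≼-refl : {A : LinOrder ℓ} → A ≼ A
  ≼-refl = (λ x → x) , λ r → r

  ≼-trans : {A B C : LinOrder ℓ} → A ≼ B → B ≼ C → A ≼ C
  ≼-trans (f , f-<) (g , g-<) = (λ x → g (f x)) , λ r → g-< (f-< r)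

  ≼-preorder : Preorder (Level.suc ℓ) (Level.suc ℓ) ℓ
  ≼-preorder = record
    { _≈_ = _≡_
    ; _≲_ = _≼_
    ; isPreorder = record
      { isEquivalence = isEquivalence
      ; reflexive = λ { {A} refl → ≼-refl {A} }
      ; trans = λ {A} {B} {C} → ≼-trans {A} {B} {C} } }

  module ≼-Reasoning = PreorderReasoning ≼-preorder

  point : (A : LinOrder ℓ) → Carrier A → 𝟙 ≼ A
  point A a = (λ _ → a) , λ ()

  Nondecreasing : (A K : LinOrder ℓ) → (Carrier A → Carrier K) → Set ℓ
  Nondecreasing A K h = ∀ {x y} → x <[ A ] y → ¬ h y <[ K ] h x

  ≼⇒nondecreasing : (A B : LinOrder ℓ) (f : A ≼ B) → Nondecreasing A B (proj₁ f)
  ≼⇒nondecreasing A B f r r' = LinOrder.irrefl B (LinOrder.trans B (proj₂ f r) r')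

  nondecreasing-reflects-< : (A K : LinOrder ℓ) (h : Carrier A → Carrier K) → Nondecreasing A K h
                           → ∀ {x y} → h x <[ K ] h y → x <[ A ] y
  nondecreasing-reflects-< A K h h-nd {x} {y} r with LinOrder.compare A x y
  ... | tri< x<y _ _    = x<y
  ... | tri≈ _ refl _   = ⊥-elim (LinOrder.irrefl K r)
  ... | tri> _ _ y<x    = ⊥-elim (h-nd y<x r)

  ≯-<-trans : (A : LinOrder ℓ) → ∀ {x y z} → ¬ y <[ A ] x → y <[ A ] z → x <[ A ] z
  ≯-<-trans A {x} {y} r s with LinOrder.compare A x y
  ... | tri< x<y _ _  = LinOrder.trans A x<y s
  ... | tri≈ _ refl _ = s
  ... | tri> _ _ y<x  = ⊥-elim (r y<x)

  step-increasing : (A : LinOrder ℓ) (s : ℕ → Carrier A) → (∀ n → s n <[ A ] s (suc n))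
                  → ∀ {m n} → suc m ≤′ n → s m <[ A ] s n
  step-increasing A s s-step {m} ≤′-refl         = s-step m
  step-increasing A s s-step     (≤′-step m<n)   = LinOrder.trans A (step-increasing A s s-step m<n) (s-step _)

  ω≼-from-step : (A : LinOrder ℓ) (s : ℕ → Carrier A) → (∀ n → s n <[ A ] s (suc n)) → ω ≼ A
  ω≼-from-step A s s-step = (λ n → s (lower n)) , λ { (lift m<n) → step-increasing A s s-step (ℕ.≤⇒≤′ m<n) }

  ∑-mono : (K L : LinOrder ℓ) (I : Carrier K → LinOrder ℓ) (J : Carrier L → LinOrder ℓ)
         → (k : K ≼ L) → (∀ x → I x ≼ J (proj₁ k x)) → ∑ K I ≼ ∑ L J
  ∑-mono K L I J k g = map , map-<
    where
    map : Carrier (∑ K I) → Carrier (∑ L J)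
    map (x , i) = proj₁ k x , proj₁ (g x) i
    map-< : ∀ {u v} → u <[ ∑ K I ] v → map u <[ ∑ L J ] map v
    map-< (here r)      = here (proj₂ k r)
    map-< (there {x} r) = there (proj₂ (g x) r)

  ∑-index-nondecreasing : (K : LinOrder ℓ) (I : Carrier K → LinOrder ℓ) → Nondecreasing (∑ K I) K proj₁
  ∑-index-nondecreasing K I (here r) r'  = LinOrder.irrefl K (LinOrder.trans K r r')
  ∑-index-nondecreasing K I (there _) r' = LinOrder.irrefl K r'

  ∑-fibre : (K : LinOrder ℓ) (I : Carrier K → LinOrder ℓ) (A : LinOrder ℓ) (g : A ≼ ∑ K I) (k : Carrier K)
          → (∀ p → proj₁ (proj₁ g p) ≡ k) → A ≼ I k
  ∑-fibre K I A g k g-in-k = (λ p → at (proj₁ g p) (g-in-k p)) , λ {p} {q} r → at-< (proj₂ g r) (g-in-k p) (g-in-k q)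
    where
    at : (u : Carrier (∑ K I)) → proj₁ u ≡ k → Carrier (I k)
    at (_ , i) refl = i
    at-< : ∀ {u v} → u <[ ∑ K I ] v → (eu : proj₁ u ≡ k) (ev : proj₁ v ≡ k) → at u eu <[ I k ] at v ev
    at-< (here r)  refl refl = ⊥-elim (LinOrder.irrefl K r)
    at-< (there r) refl refl = r

  ·-monoˡ : (C : LinOrder ℓ) {A B : LinOrder ℓ} → A ≼ B → (A · C) ≼ (B · C)
  ·-monoˡ C {A} {B} f = ∑-mono C C (λ _ → A) (λ _ → B) (≼-refl {C}) (λ _ → f)

  ·-monoʳ : (A : LinOrder ℓ) {B C : LinOrder ℓ} → B ≼ C → (A · B) ≼ (A · C)
  ·-monoʳ A {B} {C} f = ∑-mono B C (λ _ → A) (λ _ → A) f (λ _ → ≼-refl {A})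

  ·-assoc : (A B C : LinOrder ℓ) → (A · (B · C)) ≼ ((A · B) · C)
  ·-assoc A B C = reassoc , reassoc-<
    where
    reassoc : Carrier (A · (B · C)) → Carrier ((A · B) · C)
    reassoc ((c , b) , a) = c , (b , a)
    reassoc-< : ∀ {u v} → u <[ A · (B · C) ] v → reassoc u <[ (A · B) · C ] reassoc v
    reassoc-< (here (here r))  = here r
    reassoc-< (here (there r)) = there (here r)
    reassoc-< (there r)        = there (there r)

  ·-identityʳ : (A : LinOrder ℓ) → (A · 𝟙) ≼ A
  ·-identityʳ A = proj₂ , λ { (there r) → r }

  ≼-·-at : (A B : LinOrder ℓ) → Carrier B → A ≼ (A · B)
  ≼-·-at A B b = (λ a → b , a) , there

  fibre : (A B C : LinOrder ℓ) → (A · B) ≼ C → Carrier B → A ≼ C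
  fibre A B C f b = ≼-trans {A} {A · B} {C} (≼-·-at A B b) f

  ·-fibre : (A P Q : LinOrder ℓ) (g : A ≼ (P · Q))
          → (∀ p q → proj₁ (proj₁ g p) ≡ proj₁ (proj₁ g q)) → A ≼ P
  ·-fibre A P Q g g-const = (λ p → proj₂ (proj₁ g p)) , λ {p} {q} r → inner (proj₂ g r) (g-const p q)
    where
    inner : ∀ {u v} → u <[ P · Q ] v → proj₁ u ≡ proj₁ v → proj₂ u <[ P ] proj₂ v
    inner (here r)  refl = ⊥-elim (LinOrder.irrefl Q r)
    inner (there r) _    = r

  ∑-*-≼ : (K : LinOrder ℓ) (I : Carrier K → LinOrder ℓ) → (∑ K I *) ≼ ∑ (K *) (λ k → I k *)
  ∑-*-≼ K I = (λ u → u) , λ { (here r) → here r ; (there r) → there r }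

  ∑-*-≽ : (K : LinOrder ℓ) (I : Carrier K → LinOrder ℓ) → ∑ (K *) (λ k → I k *) ≼ (∑ K I *)
  ∑-*-≽ K I = (λ u → u) , λ { (here r) → here r ; (there r) → there r }

  *-mono : (A B : LinOrder ℓ) → A ≼ B → (A *) ≼ (B *)
  *-mono A B (f , f-<) = f , f-<

  _≼[<_] : LinOrder ℓ → ℕ → Set ℓ
  A ≼[< N ] = Σ (A ≼ ω) λ f → ∀ x → lower (proj₁ f x) ℕ.< N

  ≼[<]-weaken : (A : LinOrder ℓ) → ∀ {M N} → M ℕ.≤ N → A ≼[< M ] → A ≼[< N ]
  ≼[<]-weaken A M≤N (f , f<M) = f , λ x → ℕ.<-≤-trans (f<M x) M≤N

  ≼[<]-pre : (A B : LinOrder ℓ) → ∀ {N} → A ≼ B → B ≼[< N ] → A ≼[< N ]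
  ≼[<]-pre A B g (f , f<N) = ≼-trans {A} {B} {ω} g f , λ x → f<N (proj₁ g x)

  ω-≰[<] : ∀ {N} → ¬ (ω {ℓ}) ≼[< N ]
  ω-≰[<] {N} (f , f<N) = ℕ.<-irrefl refl (ℕ.≤-<-trans (above N) (f<N (lift N)))
    where
    above : ∀ k → k ℕ.≤ lower (proj₁ f (lift k))
    above zero    = z≤n
    above (suc k) = ℕ.≤-<-trans (above k) (lower (proj₂ f (lift (ℕ.n<1+n k))))

  mixed-radix-< : ∀ {a b N u} → a ℕ.< b → u ℕ.< N → a * N + u ℕ.< b * N
  mixed-radix-< {a} {b} {N} {u} a<b u<N = begin-strict
    a * N + u   <⟨ ℕ.+-monoʳ-< (a * N) u<N ⟩
    a * N + N   ≡⟨ ℕ.+-comm (a * N) N ⟩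
    suc a * N   ≤⟨ ℕ.*-monoˡ-≤ N a<b ⟩
    b * N       ∎
    where open ℕ.≤-Reasoning

  ·-≼[<] : (P Q : LinOrder ℓ) → ∀ {N M} → P ≼[< N ] → Q ≼[< M ] → (P · Q) ≼[< M * N ]
  ·-≼[<] P Q {N} {M} (f , f<N) (g , g<M) = ((λ u → lift (code u)) , λ r → lift (code-< r)) , code<MN
    where
    code : Carrier (P · Q) → ℕ
    code (q , p) = lower (proj₁ g q) * N + lower (proj₁ f p)
    code-< : ∀ {u v} → u <[ P · Q ] v → code u ℕ.< code v
    code-< (here {i = p} r) = ℕ.<-≤-trans (mixed-radix-< (lower (proj₂ g r)) (f<N p)) (ℕ.m≤m+n _ _)
    code-< (there {q} r)    = ℕ.+-monoʳ-< (lower (proj₁ g q) * N) (lower (proj₂ f r))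
    code<MN : ∀ u → code u ℕ.< M * N
    code<MN (q , p) = mixed-radix-< (g<M q) (f<N p)

  -- Blocks of a sum of finite chains are laid out one after another.
  ∑ω-≼ω : (I : ℕ → LinOrder ℓ) → (∀ n → ∃ λ N → I n ≼[< N ]) → ∑ ω (λ n → I (lower n)) ≼ ω
  ∑ω-≼ω I bounded = (λ u → lift (code u)) , λ r → lift (code-< r)
    where
    offset : ℕ → ℕ
    offset zero    = 0
    offset (suc n) = offset n + proj₁ (bounded n)
    offset-mono : ∀ {m n} → m ≤′ n → offset m ℕ.≤ offset n
    offset-mono ≤′-refl       = ℕ.≤-refl
    offset-mono (≤′-step m≤n) = ℕ.≤-trans (offset-mono m≤n) (ℕ.m≤m+n _ _)
    local : ∀ n → Carrier (I n) → ℕ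
    local n p = lower (proj₁ (proj₁ (proj₂ (bounded n))) p)
    code : Carrier (∑ ω (λ n → I (lower n))) → ℕ
    code (lift n , p) = offset n + local n p
    code-< : ∀ {u v} → u <[ ∑ ω (λ n → I (lower n)) ] v → code u ℕ.< code v
    code-< (here {lift n} {lift m} {p} (lift n<m)) =
      ℕ.<-≤-trans (ℕ.+-monoʳ-< (offset n) (proj₂ (proj₂ (bounded n)) p))
                  (ℕ.≤-trans (offset-mono (ℕ.≤⇒≤′ n<m)) (ℕ.m≤m+n _ _))
    code-< (there {lift n} r) = ℕ.+-monoʳ-< (offset n) (lower (proj₂ (proj₁ (proj₂ (bounded n))) r))

  unbounded⇒ω≼ : (A : LinOrder ℓ) (f : A ≼ ω) → (∀ N → ∃ λ x → N ℕ.≤ lower (proj₁ f x)) → ω ≼ A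
  unbounded⇒ω≼ A f reaching = ω≼-from-step A s s-step
    where
    s : ℕ → Carrier A
    s zero    = proj₁ (reaching 0)
    s (suc n) = proj₁ (reaching (suc (lower (proj₁ f (s n)))))
    s-step : ∀ n → s n <[ A ] s (suc n)
    s-step n = nondecreasing-reflects-< A ω (proj₁ f) (≼⇒nondecreasing A ω f)
                 (lift (proj₂ (reaching (suc (lower (proj₁ f (s n)))))))

  Untranscendable-resp : (φ φ' : LinOrder ℓ) → φ ≼ φ' → φ' ≼ φ → Untranscendable φ → Untranscendable φ'
  Untranscendable-resp φ φ' φ≼φ' φ'≼φ U ψ σ (ψ≼φ' , φ'⋠ψ) (σ≼φ' , φ'⋠σ) φ'≼ψσ =
    U ψ σ (≼-trans {ψ} {φ'} {φ} ψ≼φ' φ'≼φ , λ φ≼ψ → φ'⋠ψ (≼-trans {φ'} {φ} {ψ} φ'≼φ φ≼ψ))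
          (≼-trans {σ} {φ'} {φ} σ≼φ' φ'≼φ , λ φ≼σ → φ'⋠σ (≼-trans {φ'} {φ} {σ} φ'≼φ φ≼σ))
          (≼-trans {φ} {φ'} {ψ · σ} φ≼φ' φ'≼ψσ)

  Untranscendable-* : (φ : LinOrder ℓ) → Untranscendable φ → Untranscendable (φ *)
  Untranscendable-* φ U ψ σ (ψ≼φ* , φ*⋠ψ) (σ≼φ* , φ*⋠σ) φ*≼ψσ =
    U (ψ *) (σ *) (*-mono ψ (φ *) ψ≼φ* , λ φ≼ψ* → φ*⋠ψ (*-mono φ (ψ *) φ≼ψ*))
                  (*-mono σ (φ *) σ≼φ* , λ φ≼σ* → φ*⋠σ (*-mono φ (σ *) φ≼σ*))
                  (≼-trans {φ} {(ψ · σ) *} {(ψ *) · (σ *)} (*-mono (φ *) (ψ · σ) φ*≼ψσ) (∑-*-≼ σ (λ _ → ψ)))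

  module Levels (X : LinOrder ℓ) (β : Carrier X → Carrier ω) (β-nd : Nondecreasing X ω β) where

    OnLevel : LinOrder ℓ → ℕ → Set ℓ
    OnLevel A j = Σ (A ≼ X) λ g → ∀ p → β (proj₁ g p) ≡ lift j

    ∑ω-stack : (I : ℕ → LinOrder ℓ) → (∀ n k → ∃ λ j → k ℕ.≤ j × OnLevel (I n) j)
             → ∑ ω (λ n → I (lower n)) ≼ X
    ∑ω-stack I high = embed , embed-<
      where
      mutual
        floor : ℕ → ℕ
        floor zero    = zero
        floor (suc n) = suc (proj₁ (pick n))

        pick : ∀ n → ∃ λ j → floor n ℕ.≤ j × OnLevel (I n) j
        pick n = high n (floor n)

      level : ℕ → ℕ
      level n = proj₁ (pick n)
      copy : ∀ n → I n ≼ X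
      copy n = proj₁ (proj₂ (proj₂ (pick n)))
      copy-on-level : ∀ n p → β (proj₁ (copy n) p) ≡ lift (level n)
      copy-on-level n = proj₂ (proj₂ (proj₂ (pick n)))
      level-< : ∀ {m n} → suc m ≤′ n → lift (level m) <[ ω ] lift (level n)
      level-< = step-increasing ω (λ n → lift (level n)) (λ n → lift (proj₁ (proj₂ (pick (suc n)))))
      embed : Carrier (∑ ω (λ n → I (lower n))) → Carrier X
      embed (lift n , p) = proj₁ (copy n) p
      embed-< : ∀ {u v} → u <[ ∑ ω (λ n → I (lower n)) ] v → embed u <[ X ] embed v
      embed-< (here {lift m} {lift n} {p} {q} (lift m<n)) =
        nondecreasing-reflects-< X ω β β-nd
          (subst₂ (Lt ω) (sym (copy-on-level m p)) (sym (copy-on-level n q)) (level-< (ℕ.≤⇒≤′ m<n)))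
      embed-< (there {lift n} r) = proj₂ (copy n) r

  module Powers (ρ : LinOrder ℓ) where

    τ : LinOrder ℓ
    τ = powerSumω ρ

    Absorbing : Set (Level.suc ℓ)
    Absorbing = ∀ X → X ≼ τ → (∀ n → (ρ ^ n) ≼ X) → τ ≼ X

    constant : Carrier ρ → ∀ n → Carrier (ρ ^ n)
    constant x zero    = lift tt
    constant x (suc n) = x , constant x n

    ^≼∑ : ∀ n → (ρ ^ n) ≼ τ
    ^≼∑ n = (λ p → lift n , p) , there

    ^-+ : ∀ m n → ((ρ ^ m) · (ρ ^ n)) ≼ (ρ ^ (n + m))
    ^-+ m zero    = ·-identityʳ (ρ ^ m)
    ^-+ m (suc n) = begin
      (ρ ^ m) · ((ρ ^ n) · ρ)   ≲⟨ ·-assoc (ρ ^ m) (ρ ^ n) ρ ⟩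
      ((ρ ^ m) · (ρ ^ n)) · ρ   ≲⟨ ·-monoˡ ρ (^-+ m n) ⟩
      (ρ ^ (n + m)) · ρ         ∎
      where open ≼-Reasoning

  module TwoPoints (ρ : LinOrder ℓ) {x₀ x₁ : Carrier ρ} (x₀<x₁ : x₀ <[ ρ ] x₁) where
    open Powers ρ

    ^-mono : ∀ {m n} → m ≤′ n → (ρ ^ m) ≼ (ρ ^ n)
    ^-mono {m} ≤′-refl                = ≼-refl {ρ ^ m}
    ^-mono {m} (≤′-step {n} m≤n) = ≼-trans {ρ ^ m} {ρ ^ n} {ρ ^ suc n} (^-mono m≤n) (≼-·-at (ρ ^ n) ρ x₀)

    ·ρ-≼[<] : (A : LinOrder ℓ) (f : (A · ρ) ≼ ω) (a : Carrier A) → A ≼[< lower (proj₁ f (x₁ , a)) ]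
    ·ρ-≼[<] A f a = fibre A ρ ω f x₀ , λ p → lower (proj₂ f (here x₀<x₁))

    ^-≰[<] : ∀ n → ¬ (ρ ^ n) ≼[< n ]
    ^-≰[<] zero    (f , f<0)   = ℕ.n≮0 (f<0 (lift tt))
    ^-≰[<] (suc n) (f , f≤n) =
      ^-≰[<] n (≼[<]-weaken (ρ ^ n) (ℕ.≤-pred (f≤n (x₁ , a))) (·ρ-≼[<] (ρ ^ n) f a))
      where
      a : Carrier (ρ ^ n)
      a = constant x₀ n

    ω≼-of-·ρ≼ : (A : LinOrder ℓ) → Carrier A → (A · ρ) ≼ A → ω ≼ A
    ω≼-of-·ρ≼ A a f = ω≼-from-step A s s-step
      where
      s : ℕ → Carrier A
      s zero    = proj₁ f (x₀ , a)
      s (suc n) = proj₁ f (x₁ , s n)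
      s-step : ∀ n → s n <[ A ] s (suc n)
      s-step zero    = proj₂ f (here x₀<x₁)
      s-step (suc n) = proj₂ f (there (s-step n))

    Stable : ℕ → Set ℓ
    Stable j = ((ρ ^ j) · ρ) ≼ (ρ ^ j)

    stable⇒^≼ : ∀ j → Stable j → ∀ n → (ρ ^ n) ≼ (ρ ^ j)
    stable⇒^≼ j stable zero    = point (ρ ^ j) (constant x₀ j)
    stable⇒^≼ j stable (suc n) =
      ≼-trans {ρ ^ suc n} {(ρ ^ j) · ρ} {ρ ^ j} (·-monoˡ ρ (stable⇒^≼ j stable n)) stable

    stable⇒∑≼ : ∀ j → Stable j → τ ≼ (ρ ^ (j + j))
    stable⇒∑≼ j stable = begin
      τ                       ≲⟨ ∑-mono ω ω (λ n → ρ ^ lower n) (λ _ → ρ ^ j) (≼-refl {ω})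
                                   (λ n → stable⇒^≼ j stable (lower n)) ⟩
      (ρ ^ j) · ω             ≲⟨ ·-monoʳ (ρ ^ j) (ω≼-of-·ρ≼ (ρ ^ j) (constant x₀ j) stable) ⟩
      (ρ ^ j) · (ρ ^ j)       ≲⟨ ^-+ j j ⟩
      ρ ^ (j + j)             ∎
      where open ≼-Reasoning

    unstable⇒^-reflects-≤ : (∀ j → ¬ Stable j) → ∀ {a j} → (ρ ^ a) ≼ (ρ ^ j) → a ℕ.≤ j
    unstable⇒^-reflects-≤ unstable {a} {j} ρᵃ≼ρʲ with a ℕ.≤? j
    ... | yes a≤j = a≤j
    ... | no  a≰j = ⊥-elim (unstable j
                      (≼-trans {ρ ^ suc j} {ρ ^ a} {ρ ^ j} (^-mono (ℕ.≤⇒≤′ (ℕ.≰⇒> a≰j))) ρᵃ≼ρʲ))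

  module Discrete (ρ : LinOrder ℓ) (discrete : ∀ {x y} → ¬ x <[ ρ ] y) where
    open Powers ρ

    ^-discrete : ∀ n {p q} → ¬ p <[ ρ ^ n ] q
    ^-discrete zero    (lift ())
    ^-discrete (suc n) (here r)  = discrete r
    ^-discrete (suc n) (there r) = ^-discrete n r

    ∑≼ω : τ ≼ ω
    ∑≼ω = ∑ω-≼ω (ρ ^_) λ n → 1 , ((λ _ → lift 0) , λ r → ⊥-elim (^-discrete n r)) , λ _ → ℕ.s≤s z≤n

    ω≼∑ : Carrier ρ → ω ≼ τ
    ω≼∑ x = (λ n → n , constant x (lower n)) , here

  absorbing-of-empty : (ρ : LinOrder ℓ) → ¬ Carrier ρ → Powers.Absorbing ρ
  absorbing-of-empty ρ empty X _ ρⁿ≼X = (λ _ → proj₁ (ρⁿ≼X 0) (lift tt)) , λ r → ⊥-elim (incomparable r)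
    where
    incomparable : ∀ {u v} → ¬ u <[ powerSumω ρ ] v
    incomparable {lift (suc _) , x , _} _ = empty x
    incomparable {_} {lift (suc _) , x , _} _ = empty x
    incomparable {lift zero , _} {lift zero , _} (here (lift ()))
    incomparable {lift zero , _} {lift zero , _} (there (lift ()))

  ^-*-≼ : (ρ : LinOrder ℓ) → ∀ n → ((ρ ^ n) *) ≼ ((ρ *) ^ n)
  ^-*-≼ ρ zero    = ≼-refl {𝟙}
  ^-*-≼ ρ (suc n) = begin
    ((ρ ^ n) · ρ) *           ≲⟨ ∑-*-≼ ρ (λ _ → ρ ^ n) ⟩
    ((ρ ^ n) *) · (ρ *)       ≲⟨ ·-monoˡ (ρ *) (^-*-≼ ρ n) ⟩
    ((ρ *) ^ n) · (ρ *)       ∎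
    where open ≼-Reasoning

  ^-*-≽ : (ρ : LinOrder ℓ) → ∀ n → ((ρ *) ^ n) ≼ ((ρ ^ n) *)
  ^-*-≽ ρ zero    = ≼-refl {𝟙}
  ^-*-≽ ρ (suc n) = begin
    ((ρ *) ^ n) · (ρ *)       ≲⟨ ·-monoˡ (ρ *) (^-*-≽ ρ n) ⟩
    ((ρ ^ n) *) · (ρ *)       ≲⟨ ∑-*-≽ ρ (λ _ → ρ ^ n) ⟩
    ((ρ ^ n) · ρ) *           ∎
    where open ≼-Reasoning

  powerSumω*-≼ : (ρ : LinOrder ℓ) → powerSumω* ρ ≼ (powerSumω (ρ *) *)
  powerSumω*-≼ ρ = begin
    ∑ (ω *) (λ n → ρ ^ lower n)             ≲⟨ ∑-mono (ω *) (ω *) _ (λ n → ((ρ *) ^ lower n) *) (≼-refl {ω *})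
                                                 (λ n → *-mono ((ρ ^ lower n) *) ((ρ *) ^ lower n) (^-*-≼ ρ (lower n))) ⟩
    ∑ (ω *) (λ n → ((ρ *) ^ lower n) *)     ≲⟨ ∑-*-≽ ω (λ n → (ρ *) ^ lower n) ⟩
    powerSumω (ρ *) *                       ∎
    where open ≼-Reasoning

  powerSumω*-≽ : (ρ : LinOrder ℓ) → (powerSumω (ρ *) *) ≼ powerSumω* ρ
  powerSumω*-≽ ρ = begin
    powerSumω (ρ *) *                       ≲⟨ ∑-*-≼ ω (λ n → (ρ *) ^ lower n) ⟩
    ∑ (ω *) (λ n → ((ρ *) ^ lower n) *)     ≲⟨ ∑-mono (ω *) (ω *) _ (λ n → ρ ^ lower n) (≼-refl {ω *})
                                                 (λ n → *-mono ((ρ *) ^ lower n) ((ρ ^ lower n) *) (^-*-≽ ρ (lower n))) ⟩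
    ∑ (ω *) (λ n → ρ ^ lower n)             ∎
    where open ≼-Reasoning

  module Classical (lem : ExcludedMiddle ℓ) where

    dne : {P : Set ℓ} → ¬ ¬ P → P
    dne = em⇒dne lem

    ¬ω≼⇒≼[<] : (A : LinOrder ℓ) → A ≼ ω → ¬ ω ≼ A → ∃ λ N → A ≼[< N ]
    ¬ω≼⇒≼[<] A f ω⋠A = dne λ unbounded → ω⋠A (unbounded⇒ω≼ A f λ N →
      dne λ ¬reach → unbounded (N , f , λ x → ℕ.≰⇒> λ N≤ → ¬reach (x , N≤)))

    ω-untranscendable : Untranscendable (ω {ℓ})
    ω-untranscendable ψ σ (ψ≼ω , ω⋠ψ) (σ≼ω , ω⋠σ) ω≼ψσ
      with ¬ω≼⇒≼[<] ψ ψ≼ω ω⋠ψ | ¬ω≼⇒≼[<] σ σ≼ω ω⋠σ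
    ... | N , ψ≼[<N] | M , σ≼[<M] = ω-≰[<] (≼[<]-pre ω (ψ · σ) ω≼ψσ (·-≼[<] ψ σ ψ≼[<N] σ≼[<M]))

    fibre-constant⊎≼ : (A B K : LinOrder ℓ) (h : Carrier (A · B) → Carrier K) → Nondecreasing (A · B) K h
                     → (∃ λ b → ∀ p q → h (b , p) ≡ h (b , q)) ⊎ B ≼ K
    fibre-constant⊎≼ A B K h h-nd with lem {∃ λ b → ∀ p q → h (b , p) ≡ h (b , q)}
    ... | yes constant = inj₁ constant
    ... | no ¬constant = inj₂ (F , F-<)
      where
      rise : ∀ b → ∃₂ λ p q → h (b , p) <[ K ] h (b , q)
      rise b = dne λ ¬rise → ¬constant (b , λ p q → dne λ h≢ → ¬rise (orient p q h≢))
        where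
        orient : ∀ p q → ¬ h (b , p) ≡ h (b , q) → ∃₂ λ p q → h (b , p) <[ K ] h (b , q)
        orient p q h≢ with LinOrder.compare K (h (b , p)) (h (b , q))
        ... | tri< r _ _ = p , q , r
        ... | tri≈ _ e _ = ⊥-elim (h≢ e)
        ... | tri> _ _ r = q , p , r
      F : Carrier B → Carrier K
      F b = h (b , proj₁ (proj₂ (rise b)))
      -- F b sits at the top of a rise in fibre b, below the bottom of the rise in any later fibre.
      F-< : ∀ {b b'} → b <[ B ] b' → F b <[ K ] F b'
      F-< {b} {b'} b<b' = ≯-<-trans K (h-nd (here b<b')) (proj₂ (proj₂ (rise b')))

    ·≼·⇒≼⊎≼ : (A B P Q : LinOrder ℓ) → (A · B) ≼ (P · Q) → A ≼ P ⊎ B ≼ Q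
    ·≼·⇒≼⊎≼ A B P Q f with fibre-constant⊎≼ A B Q (λ u → proj₁ (proj₁ f u))
                          (λ r → ∑-index-nondecreasing Q (λ _ → P) (proj₂ f r))
    ... | inj₁ (b , constant) = inj₁ (·-fibre A P Q (fibre A B (P · Q) f b) constant)
    ... | inj₂ B≼Q            = inj₂ B≼Q

    absorbing⇒untranscendable : (ρ : LinOrder ℓ) → Powers.Absorbing ρ → Untranscendable (powerSumω ρ)
    absorbing⇒untranscendable ρ absorbing ψ σ (ψ≼τ , τ⋠ψ) (σ≼τ , τ⋠σ) τ≼ψσ =
      τ⋠ψ (absorbing ψ ψ≼τ all-in-ψ)
      where
      open Powers ρ
      split : ∀ n m → (ρ ^ n) ≼ ψ ⊎ (ρ ^ m) ≼ σ
      split n m = ·≼·⇒≼⊎≼ (ρ ^ n) (ρ ^ m) ψ σ (begin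
        (ρ ^ n) · (ρ ^ m)   ≲⟨ ^-+ n m ⟩
        ρ ^ (m + n)         ≲⟨ ^≼∑ (m + n) ⟩
        τ                   ≲⟨ τ≼ψσ ⟩
        ψ · σ               ∎)
        where open ≼-Reasoning
      all-in-ψ : ∀ n → (ρ ^ n) ≼ ψ
      all-in-ψ n = dne λ ρⁿ⋠ψ → τ⋠σ (absorbing σ σ≼τ λ m → fromInj₂ (⊥-elim ∘ ρⁿ⋠ψ) (split n m))

    module _ (ρ : LinOrder ℓ) {x₀ x₁ : Carrier ρ} (x₀<x₁ : x₀ <[ ρ ] x₁) where
      open Powers ρ
      open TwoPoints ρ x₀<x₁

      absorbing-if-finite : (∀ m → (ρ ^ m) ≼ ω) → Absorbing
      absorbing-if-finite finite X X≼τ ρⁿ≼X = ≼-trans {τ} {ω} {X} τ≼ω ω≼X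
        where
        τ≼ω : τ ≼ ω
        τ≼ω = ∑ω-≼ω (ρ ^_) λ n → _ , ·ρ-≼[<] (ρ ^ n) (finite (suc n)) (constant x₀ n)
        ω≼X : ω ≼ X
        ω≼X = dne λ ω⋠X → let (N , X≼[<N]) = ¬ω≼⇒≼[<] X (≼-trans {X} {τ} {ω} X≼τ τ≼ω) ω⋠X
                          in ^-≰[<] N (≼[<]-pre (ρ ^ N) X (ρⁿ≼X N) X≼[<N])

      absorbing-if-unstable : (∀ j → ¬ Stable j) → ¬ (∀ m → (ρ ^ m) ≼ ω) → Absorbing
      absorbing-if-unstable unstable infinite X X≼τ ρⁿ≼X = ∑ω-stack (ρ ^_) high
        where
        β : Carrier X → Carrier ω
        β x = proj₁ (proj₁ X≼τ x)
        β-nd : Nondecreasing X ω β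
        β-nd r = ∑-index-nondecreasing ω (λ n → ρ ^ lower n) (proj₂ X≼τ r)
        open Levels X β β-nd
        copy : ∀ a m → ((ρ ^ a) · (ρ ^ m)) ≼ X
        copy a m = ≼-trans {(ρ ^ a) · (ρ ^ m)} {ρ ^ (m + a)} {X} (^-+ a m) (ρⁿ≼X (m + a))
        onLevel⊎≼ω : ∀ a m → (∃ λ j → OnLevel (ρ ^ a) j) ⊎ (ρ ^ m) ≼ ω
        onLevel⊎≼ω a m with fibre-constant⊎≼ (ρ ^ a) (ρ ^ m) ω (λ u → β (proj₁ (copy a m) u))
                              (λ r → β-nd (proj₂ (copy a m) r))
        ... | inj₂ ρᵐ≼ω = inj₂ ρᵐ≼ω
        ... | inj₁ (b , constant-level) =
          inj₁ (lower (β (proj₁ (copy a m) (b , p₀))) , fibre (ρ ^ a) (ρ ^ m) X (copy a m) b ,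
                λ p → constant-level p p₀)
          where
          p₀ : Carrier (ρ ^ a)
          p₀ = constant x₀ a
        onLevel : ∀ a → ∃ λ j → OnLevel (ρ ^ a) j
        onLevel a = dne λ ¬onLevel → infinite λ m → fromInj₂ (⊥-elim ∘ ¬onLevel) (onLevel⊎≼ω a m)
        -- Block j of τ holds ρʲ, and ρᵃ ↪ ρʲ forces a ≤ j when no ρʲ is stable.
        level≥ : ∀ a j → OnLevel (ρ ^ a) j → a ℕ.≤ j
        level≥ a j (g , g-on-j) = unstable⇒^-reflects-≤ unstable
          (∑-fibre ω (λ n → ρ ^ lower n) (ρ ^ a) (≼-trans {ρ ^ a} {X} {τ} g X≼τ) (lift j) g-on-j)
        high : ∀ n k → ∃ λ j → k ℕ.≤ j × OnLevel (ρ ^ n) j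
        high n k with onLevel (k + n)
        ... | j , g , g-on-j =
          j , ℕ.≤-trans (ℕ.m≤m+n k n) (level≥ (k + n) j (g , g-on-j)) ,
          ≼-trans {ρ ^ n} {ρ ^ (k + n)} {X} (^-mono (ℕ.≤⇒≤′ (ℕ.m≤n+m n k))) g , λ p → g-on-j _

      absorbing-of-two-points : Absorbing
      absorbing-of-two-points X X≼τ ρⁿ≼X with lem {∃ Stable}
      ... | yes (j , stable) = ≼-trans {τ} {ρ ^ (j + j)} {X} (stable⇒∑≼ j stable) (ρⁿ≼X (j + j))
      ... | no ¬stable with lem {∀ m → (ρ ^ m) ≼ ω}
      ...   | yes finite  = absorbing-if-finite finite X X≼τ ρⁿ≼X
      ...   | no infinite = absorbing-if-unstable (λ j stable → ¬stable (j , stable)) infinite X X≼τ ρⁿ≼X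

    powerSumω-untranscendable : (ρ : LinOrder ℓ) → Untranscendable (powerSumω ρ)
    powerSumω-untranscendable ρ with lem {∃₂ λ x y → x <[ ρ ] y}
    ... | yes (_ , _ , x₀<x₁) = absorbing⇒untranscendable ρ (absorbing-of-two-points ρ x₀<x₁)
    ... | no ¬comparable with lem {Carrier ρ}
    ...   | yes x  = Untranscendable-resp ω (powerSumω ρ) (ω≼∑ x) ∑≼ω ω-untranscendable
      where open Discrete ρ (λ {x} {y} x<y → ¬comparable (x , y , x<y))
    ...   | no ¬x  = absorbing⇒untranscendable ρ (absorbing-of-empty ρ ¬x)


proposition4p12 : {ℓ : Level} → ExcludedMiddle ℓ → (ρ : LinOrder ℓ)
    → Untranscendable (powerSumω ρ) × Untranscendable (powerSumω* ρ)
proposition4p12 lem ρ =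
    powerSumω-untranscendable ρ
  , Untranscendable-resp (powerSumω (ρ *) *) (powerSumω* ρ) (powerSumω*-≽ ρ) (powerSumω*-≼ ρ)
      (Untranscendable-* (powerSumω (ρ *)) (powerSumω-untranscendable (ρ *)))
  where open Classical lem
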